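{- Let $G=(A,B,E)$ be a connected bipartite graph with $|A|\ge 2$, $|B|\ge 2$ and $|\Lambda(G)|>3$. (1) $G$ has at most two critical vertices, and if it has two, then $\mathcal{R}(\Lambda(G))=0$. (2) $G$ has at most one massive vertex, and if it has one, then it has no critical vertex.
   Context: All graphs are finite and undirected, with no self-loops and no multiple edges. $G=(A,B,E)$ is bipartite with vertex classes $A,B$. Two vertices $x,y$ are biconnected if they lie in the same connected component and still lie in the same connected component after deleting any single edge, or any single vertex other than $x$ and $y$. A vertex set is biconnected if every pair of its distinct vertices is biconnected. Consequently a single vertex is biconnected, while the endpoints of a bridge are not. A block is the induced subgraph on a maximal biconnected vertex set; it is singular if it has one vertex. A cut vertex is a vertex whose removal increases the number of connected components. A pendant block is either a singular block consisting of a vertex of degree $1$, or a nonsingular block containing exactly one cut vertex. $\Lambda(G)$ is the set of pendant blocks. A block is of type $A$ (resp. type $B$) if all its non-cut vertices lie in $A$ (resp. $B$). It is of type $AB$ if it has a non-cut vertex in $A$ and one in $B$. A legal pair is an unordered pair of two distinct pendant blocks with types $\{A,B\}$, $\{A,AB\}$, $\{B,AB\}$ or $\{AB,AB\}$. For $\Lambda'\subseteq\Lambda(G)$, a legal matching is a set of legal pairs of elements of $\Lambda'$ in which each element lies in at most one pair. $\mathcal{M}(\Lambda')$ is its maximum cardinality, and $\mathcal{R}(\Lambda')=|\Lambda'|-2\mathcal{M}(\Lambda')$. $\mathcal{D}(u,G)$ is the number of connected components of $G-\{u\}$ (here $G$ is connected). A cut vertex $u$ of $G$ is massive if $\mathcal{D}(u,G)-1>\mathcal{M}(\Lambda(G))+\mathcal{R}(\Lambda(G))$.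 It is critical if $\mathcal{D}(u,G)-1=\mathcal{M}(\Lambda(G))+\mathcal{R}(\Lambda(G))$. -}

module Defs where

open import Data.Nat using (ℕ; _<_; _≤_; _∸_; _*_)
open import Data.Bool using (Bool; true; false)
open import Data.Fin using (Fin)
open import Data.Fin.Subset using (Subset; _∈_; _⊆_)
open import Data.List using (List; []; _∷_; length; concatMap)
open import Data.List.Relation.Unary.All using (All)
open import Data.List.Relation.Unary.Unique.Propositional using (Unique)
open import Data.Product using (Σ; ∃; ∃₂; _×_; _,_)
open import Data.Sum using (_⊎_)
open import Data.Unit using (⊤)
open import Relation.Nullary using (¬_)
open import Relation.Binary.PropositionalEquality using (_≡_; _≢_)
open import Function.Definitions using (Injective)

Card : {A : Set} → (A → Set) → ℕ → Set
Card {A} P k =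
  Σ (Fin k → A) λ f →
    Injective _≡_ _≡_ f × (∀ i → P (f i)) × (∀ a → P a → ∃ λ i → f i ≡ a)

-- Finite simple bipartite graphs G = (A, B, E) on vertex set Fin n.
-- A vertex v is in A iff inA v ≡ true, and in B iff inA v ≡ false.

record BipGraph (n : ℕ) : Set where
  field
    adj        : Fin n → Fin n → Bool
    adj-sym    : ∀ x y → adj x y ≡ adj y x
    adj-irrefl : ∀ x → adj x x ≡ false
    inA        : Fin n → Bool
    bipartite  : ∀ x y → adj x y ≡ true → inA x ≢ inA y

data Reach {n : ℕ} (ok : Fin n → Set) (E : Fin n → Fin n → Set)
     : Fin n → Fin n → Set where
  here : ∀ {x} → ok x → Reach ok E x x
  step : ∀ {x y z} → ok x → E x y → Reach ok E y z → Reach ok E x z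

module _ {n : ℕ} (G : BipGraph n) where
  open BipGraph G

  Adj : Fin n → Fin n → Set
  Adj x y = adj x y ≡ true

  AllV : Fin n → Set
  AllV _ = ⊤

  Without : Fin n → Fin n → Set
  Without u v = v ≢ u

  AdjMinusEdge : Fin n → Fin n → Fin n → Fin n → Set
  AdjMinusEdge a b x y = Adj x y × ¬ ((x ≡ a × y ≡ b) ⊎ (x ≡ b × y ≡ a))

  Connected : Set
  Connected = ∀ x y → Reach AllV Adj x y

  IsComponent : (Fin n → Set) → Subset n → Set
  IsComponent ok C = ∃ λ v → ok v × (∀ w → (w ∈ C → Reach ok Adj v w)
                                         × (Reach ok Adj v w → w ∈ C))

  NComp : (Fin n → Set) → ℕ → Set
  NComp ok k = Card (IsComponent ok) k

  Cut : Fin n → Set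
  Cut v = ∃₂ λ k k' → NComp AllV k × NComp (Without v) k' × k < k'

  D : Fin n → ℕ → Set
  D u d = NComp (Without u) d

  Degree : Fin n → ℕ → Set
  Degree v k = Card (Adj v) k

  BiconPair : Fin n → Fin n → Set
  BiconPair x y =
    Reach AllV Adj x y
    × (∀ a b → Reach AllV (AdjMinusEdge a b) x y)
    × (∀ w → w ≢ x → w ≢ y → Reach (Without w) Adj x y)

  BiconSet : Subset n → Set
  BiconSet S = ∀ x y → x ∈ S → y ∈ S → x ≢ y → BiconPair x y

  IsBlock : Subset n → Set
  IsBlock S = BiconSet S × (∀ T → BiconSet T → S ⊆ T → T ≡ S)

  Nonsingular : Subset n → Set
  Nonsingular S = ∃₂ λ x y → x ∈ S × y ∈ S × x ≢ y

  -- pendant blocks: the elements of Λ(G)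
  Pendant : Subset n → Set
  Pendant S = IsBlock S ×
    ((∃ λ v → v ∈ S × (∀ w → w ∈ S → w ≡ v) × Degree v 1)
     ⊎ (Nonsingular S × Card (λ v → v ∈ S × Cut v) 1))

  NonCut : Subset n → Fin n → Set
  NonCut S v = v ∈ S × ¬ Cut v

  TypeA : Subset n → Set
  TypeA S = ∀ v → NonCut S v → inA v ≡ true

  TypeB : Subset n → Set
  TypeB S = ∀ v → NonCut S v → inA v ≡ false

  TypeAB : Subset n → Set
  TypeAB S = (∃ λ v → NonCut S v × inA v ≡ true)
           × (∃ λ v → NonCut S v × inA v ≡ false)

  LegalPair : Subset n → Subset n → Set
  LegalPair S T = S ≢ T ×
    ((TypeA S × TypeB T) ⊎ (TypeB S × TypeA T)
     ⊎ (TypeA S × TypeAB T) ⊎ (TypeAB S × TypeA T)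
     ⊎ (TypeB S × TypeAB T) ⊎ (TypeAB S × TypeB T)
     ⊎ (TypeAB S × TypeAB T))

  pairElems : List (Subset n × Subset n) → List (Subset n)
  pairElems = concatMap (λ { (S , T) → S ∷ T ∷ [] })

  -- a legal matching of Λ' (given as a predicate L on vertex sets,
  -- intended to satisfy L ⊆ Pendant), as a list of pairs
  LegalMatching : (Subset n → Set) → List (Subset n × Subset n) → Set
  LegalMatching L ps =
    All (λ { (S , T) → L S × L T × LegalPair S T }) ps × Unique (pairElems ps)

  MaxMatch : (Subset n → Set) → ℕ → Set
  MaxMatch L m =
    (∃ λ ps → LegalMatching L ps × length ps ≡ m)
    × (∀ ps → LegalMatching L ps → length ps ≤ m)

  RVal : (Subset n → Set) → ℕ → Set
  RVal L r = ∃₂ λ l m → Card L l × MaxMatch L m × r ≡ l ∸ 2 * m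

  Massive : Fin n → Set
  Massive u = Cut u × ∃ λ d → ∃₂ λ m r →
    D u d × MaxMatch Pendant m × RVal Pendant r × m Data.Nat.+ r < d ∸ 1

  Critical : Fin n → Set
  Critical u = Cut u × ∃ λ d → ∃₂ λ m r →
    D u d × MaxMatch Pendant m × RVal Pendant r × d ∸ 1 ≡ m Data.Nat.+ r

  AtLeastTwoInA : Set
  AtLeastTwoInA = ∃₂ λ x y → x ≢ y × inA x ≡ true × inA y ≡ true

  AtLeastTwoInB : Set
  AtLeastTwoInB = ∃₂ λ x y → x ≢ y × inA x ≡ false × inA y ≡ false

-- Each branch of a cut vertex x, i.e. each component C of G − x, contains a pendant block
-- inside C ∪ {x}: while some vertex w of the branch separates part of it from x, pass to a
-- strictly smaller branch of w; once none does, the branch is a single leaf or, together with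
-- x, a block whose only cut vertex is x. Branches at one vertex carry distinct pendant blocks,
-- and so do branches at distinct vertices x, x′ as long as neither contains the other vertex.
-- For distinct cut vertices u, v this gives (𝒟(u,G) − 1) + (𝒟(v,G) − 1) ≤ |Λ(G)|. Of three
-- cut vertices at most one separates the other two, which gives
-- (𝒟(a,G) − 1) + (𝒟(b,G) − 1) + (𝒟(c,G) − 2) ≤ |Λ(G)| for a suitable labelling a, b, c.
--
-- Since 2ℳ ≤ |Λ|, the threshold t = ℳ + ℛ equals |Λ| − ℳ, so |Λ| ≤ 2t. Two critical vertices
-- give 2t ≤ |Λ|, hence ℛ = 0; three give 3t − 1 ≤ 2t, hence |Λ| ≤ 2; a massive vertex together
-- with a second massive or a critical vertex gives 2t + 1 ≤ |Λ|.


{-# OPTIONS --safe #-}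
module Submission where

open import Defs
open import Data.Bool as Bool using (true)
open import Data.Empty using (⊥; ⊥-elim)
open import Data.Fin as Fin using (Fin; zero; suc; punchIn; punchOut; splitAt; join; _≟_)
import Data.Fin.Properties as Finₚ
open import Data.Fin.Subset using (Subset; _∈_; _∉_; _⊆_; _⊂_; ⁅_⁆)
import Data.Fin.Subset.Properties as Subsetₚ
open import Data.Fin.Subset.Induction using (⊂-wellFounded)
open import Data.List as List using (List; []; _∷_; length)
import Data.List.Relation.Unary.All as All
open import Data.List.Relation.Unary.All using ([]; _∷_)
open import Data.List.Relation.Unary.AllPairs using (_∷_)
open import Data.List.Relation.Unary.Unique.Propositional using (Unique)
open import Data.List.Membership.Propositional.Properties using (∈-lookup)
open import Data.Nat using (ℕ; zero; suc; _≤_; _<_; _+_; _∸_; _*_; z≤n; s≤s)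
import Data.Nat.Properties as ℕₚ
open import Data.Product using (Σ; ∃; ∃₂; _×_; _,_; proj₁; proj₂)
open import Data.Sum as Sum using (_⊎_; inj₁; inj₂; [_,_]′)
open import Data.Unit using (tt)
open import Data.Vec using (tabulate)
open import Data.Vec.Functional using (_++_)
import Data.Vec.Properties as Vecₚ
open import Function using (_∘_)
open import Function.Definitions using (Injective)
open import Induction.WellFounded using (Acc; acc)
open import Relation.Binary using (tri<; tri≈; tri>)
open import Relation.Binary.PropositionalEquality
  using (_≡_; _≢_; refl; sym; trans; cong; cong₂; subst; subst₂; ≢-sym; module ≡-Reasoning)
open import Relation.Nullary using (Dec; yes; no; does; ¬_; ¬?; _×-dec_; _⊎-dec_; _→-dec_)
open import Relation.Nullary.Decidable using (dec-true; map′)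
open import Relation.Unary using (Decidable)

module _ {n : ℕ} {P : Fin n → Set} (P? : Decidable P) where

  subset : Subset n
  subset = tabulate (λ x → does (P? x))

  ∈-subset⁺ : ∀ {x} → P x → x ∈ subset
  ∈-subset⁺ {x} p =
    Vecₚ.lookup⇒[]= x subset (trans (Vecₚ.lookup∘tabulate _ x) (dec-true (P? x) p))

  ∈-subset⁻ : ∀ {x} → x ∈ subset → P x
  ∈-subset⁻ {x} x∈ with P? x | trans (sym (Vecₚ.lookup∘tabulate _ x)) (Vecₚ.[]=⇒lookup x∈)
  ... | yes p | _  = p
  ... | no _  | ()

subset-⊂ : ∀ {n} {P Q : Fin n → Set} (P? : Decidable P) (Q? : Decidable Q) →
           (∀ {x} → P x → Q x) → ∀ {x} → Q x → ¬ P x → subset P? ⊂ subset Q?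
subset-⊂ P? Q? P⇒Q {x} q ¬p =
  (λ y∈ → ∈-subset⁺ Q? (P⇒Q (∈-subset⁻ P? y∈))) , x , ∈-subset⁺ Q? q , ¬p ∘ ∈-subset⁻ P?

least-satisfying : ∀ {n} {P : Fin n → Set} → Decidable P → ∀ a → P a →
                   ∃ λ r → P r × (∀ w → w Fin.< r → ¬ P w)
least-satisfying {suc n} P? a pa with P? zero
least-satisfying P? _       _  | yes p₀ = zero , p₀ , λ _ ()
least-satisfying P? zero    pa | no ¬p₀ = ⊥-elim (¬p₀ pa)
least-satisfying P? (suc a) pa | no ¬p₀ =
  let r , pr , below = least-satisfying (P? ∘ suc) a pa in
  suc r , pr , λ { zero _ → ¬p₀ ; (suc w) (s≤s w<r) → below w w<r }

distinct-from-two : ∀ {n} {a b d : Fin n} → a ≢ b → a ≢ d → b ≢ d → ∀ x y →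
                    ∃ λ z → (z ≡ a ⊎ z ≡ b ⊎ z ≡ d) × z ≢ x × z ≢ y
distinct-from-two {a = a} {b} {d} a≢b a≢d b≢d x y with a ≟ x | a ≟ y | b ≟ x | b ≟ y
... | no a≢x   | no a≢y   | _        | _        = a , inj₁ refl , a≢x , a≢y
... | _        | _        | no b≢x   | no b≢y   = b , inj₂ (inj₁ refl) , b≢x , b≢y
... | yes refl | _        | _        | yes refl = d , inj₂ (inj₂ refl) , ≢-sym a≢d , ≢-sym b≢d
... | _        | yes refl | yes refl | _        = d , inj₂ (inj₂ refl) , ≢-sym b≢d , ≢-sym a≢d
... | yes refl | _        | yes refl | _        = ⊥-elim (a≢b refl)
... | _        | yes refl | _        | yes refl = ⊥-elim (a≢b refl)

Fin-avoiding-one : ∀ {d} (i : Fin d) →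
                   Σ (Fin (d ∸ 1) → Fin d) λ g → Injective _≡_ _≡_ g × (∀ j → g j ≢ i)
Fin-avoiding-one {suc d} i = punchIn i , Finₚ.punchIn-injective i _ _ , Finₚ.punchInᵢ≢i i

Fin-avoiding-two : ∀ {d} (i i′ : Fin d) →
                   Σ (Fin (d ∸ 1 ∸ 1) → Fin d) λ g → Injective _≡_ _≡_ g × (∀ j → g j ≢ i × g j ≢ i′)
Fin-avoiding-two {suc d} i i′ with i ≟ i′
... | yes refl =
  punchIn i ∘ inject-pred d , inject-pred-injective d ∘ Finₚ.punchIn-injective i _ _ ,
  λ j → Finₚ.punchInᵢ≢i i _ , Finₚ.punchInᵢ≢i i _
  where
  inject-pred : ∀ m → Fin (m ∸ 1) → Fin m
  inject-pred (suc m) = Fin.inject₁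
  inject-pred-injective : ∀ m → Injective _≡_ _≡_ (inject-pred m)
  inject-pred-injective (suc m) = Finₚ.inject₁-injective
... | no i≢i′ =
  let h , h-inj , h≢ = Fin-avoiding-one (punchOut i≢i′) in
  punchIn i ∘ h , h-inj ∘ Finₚ.punchIn-injective i _ _ ,
  λ j → Finₚ.punchInᵢ≢i i _ ,
        λ eq → h≢ j (Finₚ.punchIn-injective i _ _ (trans eq (sym (Finₚ.punchIn-punchOut i≢i′))))

lookup-injective : ∀ {A : Set} {xs : List A} → Unique xs → Injective _≡_ _≡_ (List.lookup xs)
lookup-injective (_  ∷ _)  {zero}  {zero}  _  = refl
lookup-injective (x∉ ∷ _)  {zero}  {suc j} eq = ⊥-elim (All.lookup x∉ (∈-lookup j) eq)
lookup-injective (x∉ ∷ _)  {suc i} {zero}  eq = ⊥-elim (All.lookup x∉ (∈-lookup i) (sym eq))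
lookup-injective (_  ∷ xs) {suc i} {suc j} eq = cong suc (lookup-injective xs eq)

card-exists : ∀ {n} {P : Fin n → Set} → Decidable P → ∃ (Card P)
card-exists {zero} P? = 0 , (λ ()) , (λ {}) , (λ ()) , (λ ())
card-exists {suc n} {P} P? with card-exists (P? ∘ suc) | P? zero
... | k , f , f-inj , Pf , onto | yes p₀ = suc k , f′ , f′-inj , Pf′ , onto′
  where
  f′ : Fin (suc k) → Fin (suc n)
  f′ zero    = zero
  f′ (suc i) = suc (f i)
  f′-inj : Injective _≡_ _≡_ f′
  f′-inj {zero}  {zero}  _ = refl
  f′-inj {suc i} {suc j} e = cong suc (f-inj (Finₚ.suc-injective e))
  Pf′ : ∀ i → P (f′ i)
  Pf′ zero    = p₀
  Pf′ (suc i) = Pf i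
  onto′ : ∀ a → P a → ∃ λ i → f′ i ≡ a
  onto′ zero    _  = zero , refl
  onto′ (suc a) pa = let i , fi≡a = onto a pa in suc i , cong suc fi≡a
... | k , f , f-inj , Pf , onto | no ¬p₀ =
  k , suc ∘ f , f-inj ∘ Finₚ.suc-injective , Pf , onto′
  where
  onto′ : ∀ a → P a → ∃ λ i → suc (f i) ≡ a
  onto′ zero    p₀ = ⊥-elim (¬p₀ p₀)
  onto′ (suc a) pa = let i , fi≡a = onto a pa in i , cong suc fi≡a

card-image : ∀ {A B : Set} {P : A → Set} {Q : B → Set} {k} (g : A → B) →
             (∀ {a a′} → P a → P a′ → g a ≡ g a′ → a ≡ a′) →
             (∀ {a} → P a → Q (g a)) → (∀ b → Q b → ∃ λ a → P a × g a ≡ b) →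
             Card P k → Card Q k
card-image {Q = Q} g g-inj P⇒Q Q⇒P (f , f-inj , Pf , onto) =
  g ∘ f , (λ {i} {j} e → f-inj (g-inj (Pf i) (Pf j) e)) , P⇒Q ∘ Pf , onto′
  where
  onto′ : ∀ b → Q b → ∃ λ i → g (f i) ≡ b
  onto′ b qb = let a , pa , ga≡b = Q⇒P b qb ; i , fi≡a = onto a pa in
               i , trans (cong g fi≡a) ga≡b

injection⇒≤-card : ∀ {A : Set} {P : A → Set} {a k} → Card P k →
                   (g : Fin a → A) → Injective _≡_ _≡_ g → (∀ i → P (g i)) → a ≤ k
injection⇒≤-card (f , _ , _ , onto) g g-inj Pg = Finₚ.injective⇒≤ h-inj
  where
  h : Fin _ → Fin _
  h i = proj₁ (onto (g i) (Pg i))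
  h-inj : Injective _≡_ _≡_ h
  h-inj {i} {j} hi≡hj = g-inj (begin
    g i       ≡⟨ sym (proj₂ (onto (g i) (Pg i))) ⟩
    f (h i)   ≡⟨ cong f hi≡hj ⟩
    f (h j)   ≡⟨ proj₂ (onto (g j) (Pg j)) ⟩
    g j       ∎)
    where open ≡-Reasoning

card-unique : ∀ {A : Set} {P : A → Set} {k l} → Card P k → Card P l → k ≡ l
card-unique c@(f , f-inj , Pf , _) c′@(f′ , f′-inj , Pf′ , _) =
  ℕₚ.≤-antisym (injection⇒≤-card c′ f f-inj Pf) (injection⇒≤-card c f′ f′-inj Pf′)

card-singleton : ∀ {A : Set} {P : A → Set} {a} → P a → (∀ {b} → P b → b ≡ a) → Card P 1
card-singleton pa unique =
  (λ _ → _) , (λ { {zero} {zero} _ → refl }) , (λ _ → pa) , λ _ pb → zero , sym (unique pb)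

module _ {A : Set} (R : A → A → Set) where

  Pairwise : ∀ {a} → (Fin a → A) → Set
  Pairwise F = ∀ {i j} → i ≢ j → R (F i) (F j)

  Across : ∀ {a b} → (Fin a → A) → (Fin b → A) → Set
  Across F H = ∀ i j → R (F i) (H j)

  pairwise-++ : (∀ x y → R x y → R y x) → ∀ {a b} {F : Fin a → A} {F′ : Fin b → A} →
                Pairwise F → Pairwise F′ → Across F F′ → Pairwise (F ++ F′)
  pairwise-++ R-sym {a} {b} {F} {F′} pw pw′ across {i} {j} i≢j =
    split (splitAt a i) (splitAt a j) (i≢j ∘ splitAt-injective)
    where
    splitAt-injective : splitAt a i ≡ splitAt a j → i ≡ j
    splitAt-injective eq =
      trans (sym (Finₚ.join-splitAt a b i)) (trans (cong (join a b) eq) (Finₚ.join-splitAt a b j))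
    split : ∀ s t → s ≢ t → R ([ F , F′ ]′ s) ([ F , F′ ]′ t)
    split (inj₁ i) (inj₁ j) s≢t = pw (s≢t ∘ cong inj₁)
    split (inj₁ i) (inj₂ j) _   = across i j
    split (inj₂ i) (inj₁ j) _   = R-sym _ _ (across j i)
    split (inj₂ i) (inj₂ j) s≢t = pw′ (s≢t ∘ cong inj₂)

  across-++ : ∀ {a b c} {F : Fin a → A} {F′ : Fin b → A} {H : Fin c → A} →
              Across F H → Across F′ H → Across (F ++ F′) H
  across-++ {a} across across′ i j with splitAt a i
  ... | inj₁ i′ = across i′ j
  ... | inj₂ i′ = across′ i′ j

-- Reachability

module _ {n : ℕ} {E : Fin n → Fin n → Set} where

  ok-source : ∀ {ok x y} → Reach ok E x y → ok x
  ok-source (here o)     = o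
  ok-source (step o _ _) = o

  ok-target : ∀ {ok x y} → Reach ok E x y → ok y
  ok-target (here o)     = o
  ok-target (step _ _ r) = ok-target r

  reach-trans : ∀ {ok x y z} → Reach ok E x y → Reach ok E y z → Reach ok E x z
  reach-trans (here _)     r′ = r′
  reach-trans (step o e r) r′ = step o e (reach-trans r r′)

  reach-map : ∀ {ok ok′ : Fin n → Set} {E′ : Fin n → Fin n → Set} →
              (∀ {v} → ok v → ok′ v) → (∀ {a b} → ok a → ok b → E a b → E′ a b) →
              ∀ {x y} → Reach ok E x y → Reach ok′ E′ x y
  reach-map f g (here o)     = here (f o)
  reach-map f g (step o e r) = step (f o) (g o (ok-source r) e) (reach-map f g r)

  reach-sym : (∀ {a b} → E a b → E b a) → ∀ {ok x y} → Reach ok E x y → Reach ok E y x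
  reach-sym E-sym (here o)     = here o
  reach-sym E-sym (step o e r) = reach-trans (reach-sym E-sym r) (step (ok-source r) (E-sym e) (here o))

  reach-inside : ∀ {ok c a b} → Reach ok E c a → Reach ok E a b → Reach (Reach ok E c) E a b
  reach-inside c⇝a (here o)     = here c⇝a
  reach-inside c⇝a (step o e r) =
    step c⇝a e (reach-inside (reach-trans c⇝a (step o e (here (ok-source r)))) r)

  reach-avoiding : ∀ {ok c q u} → Reach ok E c q → ¬ Reach ok E c u →
                   Reach (λ v → ok v × v ≢ u) E c q
  reach-avoiding (here o)     ¬c⇝u = here (o , λ { refl → ¬c⇝u (here o) })
  reach-avoiding (step o e r) ¬c⇝u =
    step (o , λ { refl → ¬c⇝u (here o) }) e (reach-avoiding r (¬c⇝u ∘ step o e))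

  reach-after-last-visit : ∀ {ok} x {a y} → Reach ok E a y →
    Reach (λ v → ok v × v ≢ x) E a y ⊎ (x ≡ y ⊎ ∃ λ z → E x z × Reach (λ v → ok v × v ≢ x) E z y)
  reach-after-last-visit x {a} (here o) with a ≟ x
  ... | yes refl = inj₂ (inj₁ refl)
  ... | no a≢x   = inj₁ (here (o , a≢x))
  reach-after-last-visit x {a} (step o e r) with reach-after-last-visit x r | a ≟ x
  ... | inj₂ visit    | _        = inj₂ visit
  ... | inj₁ avoiding | yes refl = inj₂ (inj₂ (_ , e , avoiding))
  ... | inj₁ avoiding | no a≢x   = inj₁ (step (o , a≢x) e avoiding)

  reach-first-step : ∀ {ok x y} → Reach ok E x y → x ≢ y →
                     ∃ λ z → E x z × Reach (λ v → ok v × v ≢ x) E z y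
  reach-first-step {x = x} x⇝y x≢y with reach-after-last-visit x x⇝y
  ... | inj₁ avoiding          = ⊥-elim (proj₂ (ok-source avoiding) refl)
  ... | inj₂ (inj₁ x≡y)        = ⊥-elim (x≢y x≡y)
  ... | inj₂ (inj₂ first-step) = first-step

  -- Recursion on the set of allowed vertices, from which x is dropped after the first step.
  reach? : (∀ a b → Dec (E a b)) → ∀ {ok} → Decidable ok → ∀ x y → Dec (Reach ok E x y)
  reach? E? ok? = decide ok? (⊂-wellFounded _)
    where
    decide : ∀ {ok} (ok? : Decidable ok) → Acc _⊂_ (subset ok?) → ∀ x y → Dec (Reach ok E x y)
    decide {ok} ok? (acc smaller) x y with ok? x | x ≟ y
    ... | no ¬ok-x | _        = no (¬ok-x ∘ ok-source)
    ... | yes ok-x | yes refl = yes (here ok-x)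
    ... | yes ok-x | no x≢y   =
      map′ (λ (z , e , r) → step ok-x e (reach-map proj₁ (λ _ _ e → e) r))
           (λ x⇝y → reach-first-step x⇝y x≢y)
           (Finₚ.any? λ z → E? x z ×-dec decide ok′? (smaller shrinks) z y)
      where
      ok′? : Decidable (λ v → ok v × v ≢ x)
      ok′? v = ok? v ×-dec ¬? (v ≟ x)
      shrinks : subset ok′? ⊂ subset ok?
      shrinks = subset-⊂ ok′? ok? proj₁ ok-x (λ p → proj₂ p refl)

-- Components, cut vertices and separation

module _ {n : ℕ} (G : BipGraph n) where
  open BipGraph G

  adj? : ∀ x y → Dec (Adj G x y)
  adj? x y = adj x y Bool.≟ true

  Adj-sym : ∀ {x y} → Adj G x y → Adj G y x
  Adj-sym {x} {y} e = trans (adj-sym y x) e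

  Adj⇒≢ : ∀ {x y} → Adj G x y → x ≢ y
  Adj⇒≢ {x} e refl with trans (sym (adj-irrefl x)) e
  ... | ()

  module _ {ok : Fin n → Set} where

    component-closed : ∀ {C w z} → IsComponent G ok C → w ∈ C → Reach ok (Adj G) w z → z ∈ C
    component-closed (_ , _ , C≡) w∈C w⇝z = proj₂ (C≡ _) (reach-trans (proj₁ (C≡ _) w∈C) w⇝z)

    component-connected : ∀ {C w w′} → IsComponent G ok C → w ∈ C → w′ ∈ C → Reach ok (Adj G) w w′
    component-connected (_ , _ , C≡) w∈C w′∈C =
      reach-trans (reach-sym Adj-sym (proj₁ (C≡ _) w∈C)) (proj₁ (C≡ _) w′∈C)

    component-ok : ∀ {C w} → IsComponent G ok C → w ∈ C → ok w
    component-ok (_ , _ , C≡) w∈C = ok-target (proj₁ (C≡ _) w∈C)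

    component-witness : ∀ {C} (isC : IsComponent G ok C) → proj₁ isC ∈ C
    component-witness (v , ok-v , C≡) = proj₂ (C≡ v) (here ok-v)

    component-unique : ∀ {C C′ w} → IsComponent G ok C → IsComponent G ok C′ → w ∈ C → w ∈ C′ → C ≡ C′
    component-unique isC isC′ w∈C w∈C′ =
      Subsetₚ.⊆-antisym (λ z∈C → component-closed isC′ w∈C′ (component-connected isC w∈C z∈C))
                        (λ z∈C′ → component-closed isC w∈C (component-connected isC′ w∈C′ z∈C′))

    module _ (ok? : Decidable ok) where

      reachIn? : ∀ x y → Dec (Reach ok (Adj G) x y)
      reachIn? = reach? adj? ok?

      componentOf : Fin n → Subset n
      componentOf c = subset (reachIn? c)

      componentOf-isComponent : ∀ {c} → ok c → IsComponent G ok (componentOf c)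
      componentOf-isComponent {c} ok-c =
        c , ok-c , λ w → ∈-subset⁻ (reachIn? c) , ∈-subset⁺ (reachIn? c)

      -- Each component is counted through its least vertex.
      NComp-exists : ∃ (NComp G ok)
      NComp-exists =
        let k , card = card-exists IsLeast? in
        k , card-image componentOf least-injective (componentOf-isComponent ∘ proj₁) has-least card
        where
        IsLeast : Fin n → Set
        IsLeast r = ok r × (∀ w → w Fin.< r → ¬ Reach ok (Adj G) w r)
        IsLeast? : Decidable IsLeast
        IsLeast? r = ok? r ×-dec Finₚ.all? (λ w → (w Finₚ.<? r) →-dec ¬? (reachIn? w r))
        self : ∀ {a} → ok a → a ∈ componentOf a
        self ok-a = ∈-subset⁺ (reachIn? _) (here ok-a)
        least-injective : ∀ {a a′} → IsLeast a → IsLeast a′ → componentOf a ≡ componentOf a′ → a ≡ a′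
        least-injective {a} {a′} (ok-a , a-least) (ok-a′ , a′-least) same
          with Finₚ.<-cmp a a′
        ... | tri≈ _ a≡a′ _ = a≡a′
        ... | tri< a<a′ _ _ =
          ⊥-elim (a′-least a a<a′ (∈-subset⁻ (reachIn? a) (subst (a′ ∈_) (sym same) (self ok-a′))))
        ... | tri> _ _ a′<a =
          ⊥-elim (a-least a′ a′<a (∈-subset⁻ (reachIn? a′) (subst (a ∈_) same (self ok-a))))
        has-least : ∀ C → IsComponent G ok C → ∃ λ a → IsLeast a × componentOf a ≡ C
        has-least C isC@(v , ok-v , C≡) with least-satisfying (reachIn? v) v (here ok-v)
        ... | r , v⇝r , r-least =
          r , (ok-target v⇝r , λ w w<r w⇝r → r-least w w<r (reach-trans v⇝r (reach-sym Adj-sym w⇝r))) ,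
          component-unique (componentOf-isComponent (ok-target v⇝r)) isC
                           (self (ok-target v⇝r)) (proj₂ (C≡ r) v⇝r)

  infix 4 _⇝_∖_
  _⇝_∖_ : Fin n → Fin n → Fin n → Set
  x ⇝ y ∖ u = Reach (Without G u) (Adj G) x y

  without? : ∀ u → Decidable (Without G u)
  without? u v = ¬? (v ≟ u)

  reachWithout? : ∀ u x y → Dec (x ⇝ y ∖ u)
  reachWithout? u = reachIn? (without? u)

  Separates : Fin n → Fin n → Fin n → Set
  Separates v x y = x ≢ v × y ≢ v × ¬ (x ⇝ y ∖ v)

  cut⇒separates : ∀ {v} → Cut G v → ∃₂ (Separates v)
  cut⇒separates {v} (k , k′ , (_ , _ , _ , onto) , comps , k<k′) =
    two-components (ℕₚ.≤-trans (s≤s 1≤k) k<k′) comps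
    where
    1≤k : 1 ≤ k
    1≤k = let i , _ = onto _ (componentOf-isComponent (λ _ → yes tt) {v} tt) in
          ℕₚ.≤-trans (s≤s z≤n) (Finₚ.toℕ<n i)
    two-components : ∀ {k′} → 2 ≤ k′ → NComp G (Without G v) k′ → ∃₂ (Separates v)
    two-components {suc (suc _)} _ (C , C-inj , isC , _) =
      proj₁ (isC zero) , proj₁ (isC (suc zero)) ,
      proj₁ (proj₂ (isC zero)) , proj₁ (proj₂ (isC (suc zero))) ,
      λ x⇝y → 0≢1 (C-inj (component-unique (isC zero) (isC (suc zero))
                 (component-closed (isC zero) (component-witness (isC zero)) x⇝y)
                 (component-witness (isC (suc zero)))))
      where
      0≢1 : zero ≢ suc zero
      0≢1 ()
    two-components {suc zero} (s≤s ()) _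

  connected⇒NComp≤1 : Connected G → ∀ {k} → NComp G (AllV G) k → k ≤ 1
  connected⇒NComp≤1 conn (C , C-inj , isC , _) = Finₚ.injective⇒≤ {f = λ _ → zero {0}} λ _ →
    C-inj (component-unique (isC _) (isC _) (component-witness (isC _))
                            (component-closed (isC _) (component-witness (isC _)) (conn _ _)))

  separates⇒cut : Connected G → ∀ {v x y} → Separates v x y → Cut G v
  separates⇒cut conn {v} {x} {y} (x≢v , y≢v , ¬x⇝y) =
    let k , comps = NComp-exists (λ _ → yes tt)
        k′ , comps′@(C , _ , _ , onto) = NComp-exists (without? v)
        i , Ci≡ = onto _ (componentOf-isComponent (without? v) x≢v)
        j , Cj≡ = onto _ (componentOf-isComponent (without? v) y≢v)
        i≢j : i ≢ j
        i≢j = λ i≡j → ¬x⇝y (same-component⇒reach (trans (sym Ci≡) (trans (cong C i≡j) Cj≡)))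
    in k , k′ , comps , comps′ , ℕₚ.≤-trans (s≤s (connected⇒NComp≤1 conn comps)) (two-distinct⇒2≤ i≢j)
    where
    same-component⇒reach : componentOf (without? v) x ≡ componentOf (without? v) y → x ⇝ y ∖ v
    same-component⇒reach same =
      ∈-subset⁻ (reachWithout? v x) (subst (y ∈_) (sym same) (∈-subset⁺ (reachWithout? v y) (here y≢v)))
    two-distinct⇒2≤ : ∀ {k} {i j : Fin k} → i ≢ j → 2 ≤ k
    two-distinct⇒2≤ {suc zero}    {zero} {zero} i≢j = ⊥-elim (i≢j refl)
    two-distinct⇒2≤ {suc (suc _)} _ = s≤s (s≤s z≤n)

  reach-one-avoiding-other : ∀ {x y p} → x ≢ y → Reach (AllV G) (Adj G) p x → p ≢ x → p ≢ y →
                             p ⇝ x ∖ y ⊎ p ⇝ y ∖ x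
  reach-one-avoiding-other x≢y (here _) p≢x _ = ⊥-elim (p≢x refl)
  reach-one-avoiding-other {x} {y} x≢y (step {y = b} _ e b⇝x) p≢x p≢y with b ≟ x | b ≟ y
  ... | yes refl | _        = inj₁ (step p≢y e (here x≢y))
  ... | no _     | yes refl = inj₂ (step p≢x e (here (x≢y ∘ sym)))
  ... | no b≢x   | no b≢y   =
    Sum.map (step p≢y e) (step p≢x e) (reach-one-avoiding-other x≢y b⇝x b≢x b≢y)

  avoiding-endpoint⇒avoiding-edge : ∀ {e a b p q} → e ≡ a ⊎ e ≡ b → p ⇝ q ∖ e →
                                    Reach (AllV G) (AdjMinusEdge G a b) p q
  avoiding-endpoint⇒avoiding-edge e∈ab = reach-map (λ _ → tt) λ p≢e q≢e adj → adj , not-ab e∈ab p≢e q≢e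
    where
    not-ab : ∀ {e a b p q} → e ≡ a ⊎ e ≡ b → p ≢ e → q ≢ e → ¬ ((p ≡ a × q ≡ b) ⊎ (p ≡ b × q ≡ a))
    not-ab (inj₁ refl) p≢e _   (inj₁ (refl , _)) = p≢e refl
    not-ab (inj₁ refl) _   q≢e (inj₂ (_ , refl)) = q≢e refl
    not-ab (inj₂ refl) _   q≢e (inj₁ (_ , refl)) = q≢e refl
    not-ab (inj₂ refl) p≢e _   (inj₂ (refl , _)) = p≢e refl

  avoiding-loop : ∀ {a p q} → Reach (AllV G) (Adj G) p q → Reach (AllV G) (AdjMinusEdge G a a) p q
  avoiding-loop = reach-map (λ _ → tt) λ _ _ adj → adj , λ { (inj₁ (refl , refl)) → Adj⇒≢ adj refl
                                                          ; (inj₂ (refl , refl)) → Adj⇒≢ adj refl }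

  -- With a third vertex z available, x reaches y through z avoiding first y and then x,
  -- which handles the deleted edge {x, y}; every other edge has an endpoint outside {x, y}.
  vertexConnected⇒BiconSet : Connected G → ∀ {S : Fin n → Set} (S? : Decidable S) →
    (∀ {x y} → S x → S y → ∃ λ z → S z × z ≢ x × z ≢ y) →
    (∀ {w x y} → S x → S y → x ≢ w → y ≢ w → x ⇝ y ∖ w) →
    BiconSet G (subset S?)
  vertexConnected⇒BiconSet conn {S} S? third connected x y x∈ y∈ x≢y =
    conn x y , avoiding-edge , λ w w≢x w≢y → connected Sx Sy (w≢x ∘ sym) (w≢y ∘ sym)
    where
    Sx : S x
    Sx = ∈-subset⁻ S? x∈
    Sy : S y
    Sy = ∈-subset⁻ S? y∈
    via-third : ∀ {a b} → x ≡ a ⊎ x ≡ b → y ≡ a ⊎ y ≡ b → Reach (AllV G) (AdjMinusEdge G a b) x y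
    via-third x∈ab y∈ab =
      let z , Sz , z≢x , z≢y = third Sx Sy in
      reach-trans (avoiding-endpoint⇒avoiding-edge y∈ab (connected Sx Sz x≢y z≢y))
                  (avoiding-endpoint⇒avoiding-edge x∈ab (connected Sz Sy z≢x (x≢y ∘ sym)))
    avoiding-edge : ∀ a b → Reach (AllV G) (AdjMinusEdge G a b) x y
    avoiding-edge a b with a ≟ b | a ≟ x | a ≟ y | b ≟ x | b ≟ y
    ... | yes refl | _        | _        | _        | _ = avoiding-loop (conn x y)
    ... | no _     | no a≢x   | no a≢y   | _        | _ =
      avoiding-endpoint⇒avoiding-edge (inj₁ refl) (connected Sx Sy (a≢x ∘ sym) (a≢y ∘ sym))
    ... | no _     | _        | _        | no b≢x   | no b≢y =
      avoiding-endpoint⇒avoiding-edge (inj₂ refl) (connected Sx Sy (b≢x ∘ sym) (b≢y ∘ sym))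
    ... | no a≢b   | yes refl | _        | _        | yes refl = via-third (inj₁ refl) (inj₂ refl)
    ... | no a≢b   | _        | yes refl | yes refl | _        = via-third (inj₂ refl) (inj₁ refl)
    ... | no a≢b   | yes refl | _        | yes refl | _        = ⊥-elim (a≢b refl)
    ... | no a≢b   | _        | yes refl | _        | yes refl = ⊥-elim (a≢b refl)

  module _ (conn : Connected G) where

    -- A pendant block in every branch

    PendantInBranch : Fin n → Fin n → Set
    PendantInBranch u c = ∃ λ P → Pendant G P × (∃ λ p → p ∈ P × c ⇝ p ∖ u)
                                × (∀ {q} → q ∈ P → q ≡ u ⊎ c ⇝ q ∖ u)

    neighbour-in-branch : ∀ {u c} → c ≢ u → ∃ λ z → c ⇝ z ∖ u × Adj G z u
    neighbour-in-branch {u} {c} c≢u =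
      let z , u~z , z⇝c = reach-first-step (conn u c) (≢-sym c≢u) in
      z , reach-sym Adj-sym (reach-map proj₂ (λ _ _ e → e) z⇝c) , Adj-sym u~z

    singleton-pendant : ∀ {u c} → c ≢ u → (∀ {w} → c ⇝ w ∖ u → w ≡ c) → Pendant G ⁅ c ⁆
    singleton-pendant {u} {c} c≢u only-c =
      (biconnected , maximal) , inj₁ (c , Subsetₚ.x∈⁅x⁆ c , (λ _ → Subsetₚ.x∈⁅y⁆⇒x≡y c) , degree-one)
      where
      neighbour≡u : ∀ {y} → Adj G c y → y ≡ u
      neighbour≡u {y} c~y with y ≟ u
      ... | yes y≡u = y≡u
      ... | no y≢u  = ⊥-elim (Adj⇒≢ c~y (sym (only-c (step c≢u c~y (here y≢u)))))
      degree-one : Degree G c 1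
      degree-one = let z , c⇝z , z~u = neighbour-in-branch c≢u in
        card-singleton (subst (λ z → Adj G z u) (only-c c⇝z) z~u) neighbour≡u
      stuck : ∀ {z} → Reach (AllV G) (AdjMinusEdge G c u) c z → z ≡ c
      stuck (here _)                  = refl
      stuck (step _ (c~y , not-cu) _) = ⊥-elim (not-cu (inj₁ (refl , neighbour≡u c~y)))
      biconnected : BiconSet G ⁅ c ⁆
      biconnected x y x∈ y∈ x≢y =
        ⊥-elim (x≢y (trans (Subsetₚ.x∈⁅y⁆⇒x≡y c x∈) (sym (Subsetₚ.x∈⁅y⁆⇒x≡y c y∈))))
      maximal : ∀ T → BiconSet G T → ⁅ c ⁆ ⊆ T → T ≡ ⁅ c ⁆
      maximal T T-bicon c∈T = Subsetₚ.⊆-antisym T⊆c c∈T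
        where
        T⊆c : T ⊆ ⁅ c ⁆
        T⊆c {z} z∈T with z ≟ c
        ... | yes refl = Subsetₚ.x∈⁅x⁆ c
        ... | no z≢c   = ⊥-elim (z≢c (stuck
          (proj₁ (proj₂ (T-bicon c z (c∈T (Subsetₚ.x∈⁅x⁆ c)) z∈T (≢-sym z≢c))) c u)))

    module _ {u c : Fin n} (c≢u : c ≢ u) where

      InBlock : Fin n → Set
      InBlock v = v ≡ u ⊎ c ⇝ v ∖ u

      inBlock? : Decidable InBlock
      inBlock? v = (v ≟ u) ⊎-dec reachWithout? u c v

      block : Subset n
      block = subset inBlock?

      c∈block : c ∈ block
      c∈block = ∈-subset⁺ inBlock? (inj₂ (here c≢u))

      u∈block : u ∈ block
      u∈block = ∈-subset⁺ inBlock? (inj₁ refl)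

      reach-within-block : ∀ {x} → InBlock x → Reach InBlock (Adj G) c x
      reach-within-block (inj₁ refl) =
        let z , c⇝z , z~u = neighbour-in-branch c≢u in
        reach-trans (reach-within-block (inj₂ c⇝z)) (step (inj₂ c⇝z) z~u (here (inj₁ refl)))
      reach-within-block (inj₂ c⇝x) = reach-map inj₂ (λ _ _ e → e) (reach-inside (here c≢u) c⇝x)

      block-maximal : ∀ T → BiconSet G T → block ⊆ T → T ≡ block
      block-maximal T T-bicon block⊆T = Subsetₚ.⊆-antisym T⊆block block⊆T
        where
        T⊆block : T ⊆ block
        T⊆block {z} z∈T with z ≟ u | z ≟ c
        ... | yes z≡u | _        = ∈-subset⁺ inBlock? (inj₁ z≡u)
        ... | no _    | yes refl = c∈block
        ... | no z≢u  | no z≢c   = ∈-subset⁺ inBlock? (inj₂ (proj₂ (proj₂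
          (T-bicon c z (block⊆T c∈block) z∈T (≢-sym z≢c))) u (≢-sym c≢u) (≢-sym z≢u)))

      module _ (through-u : ∀ {w x} → c ⇝ w ∖ u → x ≢ w → x ⇝ u ∖ w) where

        block-vertexConnected : ∀ {w x y} → InBlock x → InBlock y → x ≢ w → y ≢ w → x ⇝ y ∖ w
        block-vertexConnected {w} Bx By x≢w y≢w with w ≟ u | reachWithout? u c w
        ... | yes refl | _ =
          reach-trans (reach-sym Adj-sym (in-branch Bx x≢w)) (in-branch By y≢w)
          where
          in-branch : ∀ {x} → InBlock x → x ≢ u → c ⇝ x ∖ u
          in-branch = [ (λ x≡u x≢u → ⊥-elim (x≢u x≡u)) , (λ c⇝x _ → c⇝x) ]′
        ... | no _     | yes c⇝w =
          reach-trans (through-u c⇝w x≢w) (reach-sym Adj-sym (through-u c⇝w y≢w))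
        ... | no w≢u   | no ¬c⇝w =
          reach-map (λ Bv v≡w → [ w≢u , ¬c⇝w ]′ (subst InBlock v≡w Bv)) (λ _ _ e → e)
                    (reach-trans (reach-sym Adj-sym (reach-within-block Bx)) (reach-within-block By))

        block-cut-vertices : Cut G u → Card (λ v → v ∈ block × Cut G v) 1
        block-cut-vertices cut-u = card-singleton (u∈block , cut-u) λ (v∈block , cut-v) →
          [ (λ v≡u → v≡u) , (λ c⇝v → ⊥-elim (not-cut c⇝v cut-v)) ]′ (∈-subset⁻ inBlock? v∈block)
          where
          not-cut : ∀ {v} → c ⇝ v ∖ u → ¬ Cut G v
          not-cut c⇝v cut-v =
            let x , y , x≢v , y≢v , ¬x⇝y = cut⇒separates cut-v in
            ¬x⇝y (reach-trans (through-u c⇝v x≢v) (reach-sym Adj-sym (through-u c⇝v y≢v)))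

        block-pendant : ∀ {c₂} → Cut G u → c ⇝ c₂ ∖ u → c₂ ≢ c → PendantInBranch u c
        block-pendant {c₂} cut-u c⇝c₂ c₂≢c =
          block , ((biconnected , block-maximal) ,
                   inj₂ ((c , u , c∈block , u∈block , c≢u) , block-cut-vertices cut-u)) ,
          (c , c∈block , here c≢u) , ∈-subset⁻ inBlock?
          where
          third : ∀ {x y} → InBlock x → InBlock y → ∃ λ z → InBlock z × z ≢ x × z ≢ y
          third {x} {y} _ _ with distinct-from-two (≢-sym c₂≢c) c≢u (ok-target c⇝c₂) x y
          ... | z , inj₁ refl        , z≢x , z≢y = z , inj₂ (here c≢u) , z≢x , z≢y
          ... | z , inj₂ (inj₁ refl) , z≢x , z≢y = z , inj₂ c⇝c₂ , z≢x , z≢y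
          ... | z , inj₂ (inj₂ refl) , z≢x , z≢y = z , inj₁ refl , z≢x , z≢y
          biconnected : BiconSet G block
          biconnected = vertexConnected⇒BiconSet conn inBlock? third block-vertexConnected

    SplitsBranch : Fin n → Fin n → Set
    SplitsBranch u c = ∃ λ w → c ⇝ w ∖ u × ∃ λ x → Separates w x u

    splitsBranch? : ∀ u c → Dec (SplitsBranch u c)
    splitsBranch? u c = Finₚ.any? λ w → reachWithout? u c w ×-dec Finₚ.any? λ x →
      ¬? (x ≟ w) ×-dec ¬? (u ≟ w) ×-dec ¬? (reachWithout? w x u)

    ¬splits⇒through-root : ∀ {u c w x} → ¬ SplitsBranch u c → c ⇝ w ∖ u → x ≢ w → x ⇝ u ∖ w
    ¬splits⇒through-root {u} {w = w} {x} ¬splits c⇝w x≢w with reachWithout? w x u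
    ... | yes x⇝u = x⇝u
    ... | no ¬x⇝u = ⊥-elim (¬splits (w , c⇝w , x , x≢w , ≢-sym (ok-target c⇝w) , ¬x⇝u))

    unsplit-branch-pendant : ∀ {u c} → Cut G u → c ≢ u → ¬ SplitsBranch u c → PendantInBranch u c
    unsplit-branch-pendant {u} {c} cut-u c≢u ¬splits
      with Finₚ.any? (λ c₂ → reachWithout? u c c₂ ×-dec ¬? (c₂ ≟ c))
    ... | yes (c₂ , c⇝c₂ , c₂≢c) = block-pendant c≢u (¬splits⇒through-root ¬splits) cut-u c⇝c₂ c₂≢c
    ... | no ¬other =
      ⁅ c ⁆ , singleton-pendant c≢u only-c , (c , Subsetₚ.x∈⁅x⁆ c , here c≢u) ,
      λ q∈ → inj₂ (subst (c ⇝_∖ u) (sym (Subsetₚ.x∈⁅y⁆⇒x≡y c q∈)) (here c≢u))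
      where
      only-c : ∀ {w} → c ⇝ w ∖ u → w ≡ c
      only-c {w} c⇝w with w ≟ c
      ... | yes w≡c = w≡c
      ... | no w≢c  = ⊥-elim (¬other (w , c⇝w , w≢c))

    branch-nested : ∀ {u c w x} → c ⇝ w ∖ u → Separates w x u → ∀ {q} → x ⇝ q ∖ w → c ⇝ q ∖ u
    branch-nested {u} {c} {w} {x} c⇝w (x≢w , u≢w , ¬x⇝u) x⇝q =
      reach-trans c⇝x (reach-map proj₂ (λ _ _ e → e) (reach-avoiding x⇝q ¬x⇝u))
      where
      x≢u : x ≢ u
      x≢u refl = ¬x⇝u (here u≢w)
      c⇝x : c ⇝ x ∖ u
      c⇝x with reach-one-avoiding-other u≢w (conn x u) x≢u x≢w
      ... | inj₁ x⇝u = ⊥-elim (¬x⇝u x⇝u)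
      ... | inj₂ x⇝w = reach-trans c⇝w (reach-sym Adj-sym x⇝w)

    pendant-in-branch : ∀ {u c} → Cut G u → c ≢ u → PendantInBranch u c
    pendant-in-branch = descend (⊂-wellFounded _)
      where
      descend : ∀ {u c} → Acc _⊂_ (subset (reachWithout? u c)) → Cut G u → c ≢ u → PendantInBranch u c
      descend {u} {c} (acc smaller) cut-u c≢u with splitsBranch? u c
      ... | no ¬splits = unsplit-branch-pendant cut-u c≢u ¬splits
      ... | yes (w , c⇝w , x , sep@(x≢w , _)) =
        let P , P-pendant , (p , p∈P , x⇝p) , P⊆ =
              descend (smaller shrinks) (separates⇒cut conn sep) x≢w in
        P , P-pendant , (p , p∈P , nested x⇝p) ,
        λ q∈P → inj₂ ([ (λ { refl → c⇝w }) , nested ]′ (P⊆ q∈P))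
        where
        nested : ∀ {q} → x ⇝ q ∖ w → c ⇝ q ∖ u
        nested = branch-nested c⇝w sep
        shrinks : subset (reachWithout? w x) ⊂ subset (reachWithout? u c)
        shrinks = subset-⊂ (reachWithout? w x) (reachWithout? u c) nested c⇝w
                           (λ x⇝w → ok-target x⇝w refl)

    -- Separated branches carry distinct pendant blocks

    PendantIn : Fin n → Subset n → Subset n → Set
    PendantIn x C P = Pendant G P × (∃ λ p → p ∈ P × p ∈ C) × (∀ {q} → q ∈ P → q ≡ x ⊎ q ∈ C)

    pendant-in-component : ∀ {x C} → Cut G x → IsComponent G (Without G x) C → ∃ (PendantIn x C)
    pendant-in-component {x} {C} cut-x isC@(c , c≢x , _) =
      let P , P-pendant , (p , p∈P , c⇝p) , P⊆ = pendant-in-branch cut-x c≢x in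
      P , P-pendant , (p , p∈P , in-C c⇝p) , λ q∈P → Sum.map₂ in-C (P⊆ q∈P)
      where
      in-C : ∀ {q} → c ⇝ q ∖ x → q ∈ C
      in-C = component-closed isC (component-witness isC)

    Separated : Fin n → Subset n → Fin n → Subset n → Set
    Separated x C x′ C′ = (x ≡ x′ × C ≢ C′) ⊎ (x ≢ x′ × x′ ∉ C × x ∉ C′)

    separated⇒distinct-pendants :
      ∀ {x C P x′ C′ P′} → IsComponent G (Without G x) C → IsComponent G (Without G x′) C′ →
      PendantIn x C P → PendantIn x′ C′ P′ → Separated x C x′ C′ → P ≢ P′
    separated⇒distinct-pendants {x} isC isC′ (_ , (p , p∈P , p∈C) , _) (_ , _ , P′⊆) sep refl
      with P′⊆ p∈P | sep
    ... | inj₁ refl | inj₁ (refl , _)      = component-ok isC p∈C refl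
    ... | inj₁ refl | inj₂ (_ , x′∉C , _)  = x′∉C p∈C
    ... | inj₂ p∈C′ | inj₁ (refl , C≢C′)   = C≢C′ (component-unique isC isC′ p∈C p∈C′)
    ... | inj₂ p∈C′ | inj₂ (x≢x′ , x′∉C , x∉C′)
      with reach-one-avoiding-other x≢x′ (conn p x) (component-ok isC p∈C) (component-ok isC′ p∈C′)
    ...   | inj₁ p⇝x = x∉C′ (component-closed isC′ p∈C′ p⇝x)
    ...   | inj₂ p⇝x′ = x′∉C (component-closed isC p∈C p⇝x′)

    record Branch : Set where
      field
        root        : Fin n
        component   : Subset n
        root-cut    : Cut G root
        isComponent : IsComponent G (Without G root) component

      pendant : ∃ (PendantIn root component)
      pendant = pendant-in-component root-cut isComponent

    open Branch

    SeparatedBranches : Branch → Branch → Set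
    SeparatedBranches b b′ = Separated (root b) (component b) (root b′) (component b′)

    separatedBranches-sym : ∀ b b′ → SeparatedBranches b b′ → SeparatedBranches b′ b
    separatedBranches-sym _ _ (inj₁ (x≡x′ , C≢C′))        = inj₁ (sym x≡x′ , ≢-sym C≢C′)
    separatedBranches-sym _ _ (inj₂ (x≢x′ , x′∉C , x∉C′)) = inj₂ (≢-sym x≢x′ , x∉C′ , x′∉C)

    separated-branches-≤ : ∀ {a k} (F : Fin a → Branch) → Pairwise SeparatedBranches F →
                           Card (Pendant G) k → a ≤ k
    separated-branches-≤ F separated card =
      injection⇒≤-card card (proj₁ ∘ pendant ∘ F) distinct (proj₁ ∘ proj₂ ∘ pendant ∘ F)
      where
      distinct : Injective _≡_ _≡_ (proj₁ ∘ pendant ∘ F)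
      distinct {i} {j} same with i ≟ j
      ... | yes i≡j = i≡j
      ... | no i≢j  = ⊥-elim (separated⇒distinct-pendants (isComponent (F i)) (isComponent (F j))
                               (proj₂ (pendant (F i))) (proj₂ (pendant (F j))) (separated i≢j) same)

    record Fan (x y z : Fin n) (a : ℕ) : Set where
      field
        comp             : Fin a → Subset n
        comp-injective   : Injective _≡_ _≡_ comp
        comp-isComponent : ∀ i → IsComponent G (Without G x) (comp i)
        comp-avoids      : ∀ i → y ∉ comp i × z ∉ comp i

    open Fan

    fan-branches : ∀ {x y z a} → Cut G x → Fan x y z a → Fin a → Branch
    fan-branches {x} cut-x F i = record
      { root = x ; component = comp F i ; root-cut = cut-x ; isComponent = comp-isComponent F i }

    fan-separated : ∀ {x y z a} (cut-x : Cut G x) (F : Fan x y z a) →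
                    Pairwise SeparatedBranches (fan-branches cut-x F)
    fan-separated cut-x F i≢j = inj₁ (refl , i≢j ∘ comp-injective F)

    fans-separated : ∀ {x y z a x′ y′ z′ a′} (cut-x : Cut G x) (cut-x′ : Cut G x′) →
                     (F : Fan x y z a) (F′ : Fan x′ y′ z′ a′) →
                     x ≢ x′ → x′ ≡ y ⊎ x′ ≡ z → x ≡ y′ ⊎ x ≡ z′ →
                     Across SeparatedBranches (fan-branches cut-x F) (fan-branches cut-x′ F′)
    fans-separated cut-x cut-x′ F F′ x≢x′ x′-avoided x-avoided i j =
      inj₂ (x≢x′ , avoided F i x′-avoided , avoided F′ j x-avoided)
      where
      avoided : ∀ {x y z a v} (F : Fan x y z a) i → v ≡ y ⊎ v ≡ z → v ∉ comp F i
      avoided F i (inj₁ refl) = proj₁ (comp-avoids F i)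
      avoided F i (inj₂ refl) = proj₂ (comp-avoids F i)

    module _ {x d} (Dx : D G x d) where
      private
        f : Fin d → Subset n
        f = proj₁ Dx
        f-inj : Injective _≡_ _≡_ f
        f-inj = proj₁ (proj₂ Dx)
        isC : ∀ i → IsComponent G (Without G x) (f i)
        isC = proj₁ (proj₂ (proj₂ Dx))
        onto : ∀ C → IsComponent G (Without G x) C → ∃ λ i → f i ≡ C
        onto = proj₂ (proj₂ (proj₂ Dx))

      index : ∀ {y} → y ≢ x → Fin d
      index y≢x = proj₁ (onto _ (componentOf-isComponent (without? x) y≢x))

      ∈-index : ∀ {y} (y≢x : y ≢ x) {v} → y ⇝ v ∖ x → v ∈ f (index y≢x)
      ∈-index {y} y≢x y⇝v = component-closed (isC _)
        (subst (y ∈_) (sym (proj₂ (onto _ (componentOf-isComponent (without? x) y≢x))))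
               (∈-subset⁺ (reachWithout? x y) (here y≢x)))
        y⇝v

      index-unique : ∀ {y} (y≢x : y ≢ x) {i v} → y ⇝ v ∖ x → v ∈ f i → i ≡ index y≢x
      index-unique y≢x y⇝v v∈fi = f-inj (component-unique (isC _) (isC _) v∈fi (∈-index y≢x y⇝v))

      fan-avoiding-one : ∀ {y z} → y ≢ x → y ⇝ z ∖ x → Fan x y z (d ∸ 1)
      fan-avoiding-one {y} y≢x y⇝z =
        let g , g-inj , g≢ = Fin-avoiding-one (index y≢x) in record
          { comp = f ∘ g ; comp-injective = g-inj ∘ f-inj ; comp-isComponent = isC ∘ g
          ; comp-avoids = λ j → (g≢ j ∘ index-unique y≢x (here y≢x)) , (g≢ j ∘ index-unique y≢x y⇝z) }

      fan-avoiding-two : ∀ {y z} → y ≢ x → z ≢ x → Fan x y z (d ∸ 1 ∸ 1)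
      fan-avoiding-two y≢x z≢x =
        let g , g-inj , g≢ = Fin-avoiding-two (index y≢x) (index z≢x) in record
          { comp = f ∘ g ; comp-injective = g-inj ∘ f-inj ; comp-isComponent = isC ∘ g
          ; comp-avoids = λ j → (proj₁ (g≢ j) ∘ index-unique y≢x (here y≢x))
                              , (proj₂ (g≢ j) ∘ index-unique z≢x (here z≢x)) }

    pair-bound : ∀ {u v du dv k} → u ≢ v → Cut G u → Cut G v → D G u du → D G v dv →
                 Card (Pendant G) k → (du ∸ 1) + (dv ∸ 1) ≤ k
    pair-bound {u} {v} {du} {dv} u≢v cut-u cut-v Du Dv card =
      separated-branches-≤ (fan-branches cut-u Fu ++ fan-branches cut-v Fv)
        (pairwise-++ SeparatedBranches separatedBranches-sym
                     (fan-separated cut-u Fu) (fan-separated cut-v Fv)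
                     (fans-separated cut-u cut-v Fu Fv u≢v (inj₁ refl) (inj₁ refl)))
        card
      where
      Fu : Fan u v v (du ∸ 1)
      Fu = fan-avoiding-one Du (≢-sym u≢v) (here (≢-sym u≢v))
      Fv : Fan v u u (dv ∸ 1)
      Fv = fan-avoiding-one Dv u≢v (here u≢v)

    triple-bound : ∀ {a b c da db dc k} → a ≢ b → a ≢ c → b ≢ c → Cut G a → Cut G b → Cut G c →
                   D G a da → D G b db → D G c dc → b ⇝ c ∖ a → a ⇝ c ∖ b →
                   Card (Pendant G) k → (da ∸ 1) + (db ∸ 1) + (dc ∸ 1 ∸ 1) ≤ k
    triple-bound {a} {b} {c} {da} {db} {dc} a≢b a≢c b≢c cut-a cut-b cut-c Da Db Dc b⇝c a⇝c card =
      separated-branches-≤ ((Ba ++ Bb) ++ Bc)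
        (pairwise-++ SeparatedBranches separatedBranches-sym {F = Ba ++ Bb} {Bc}
          (pairwise-++ SeparatedBranches separatedBranches-sym {F = Ba} {Bb}
            (fan-separated cut-a Fa) (fan-separated cut-b Fb)
            (fans-separated cut-a cut-b Fa Fb a≢b (inj₁ refl) (inj₁ refl)))
          (fan-separated cut-c Fc)
          (across-++ SeparatedBranches {F = Ba} {Bb} {Bc}
            (fans-separated cut-a cut-c Fa Fc a≢c (inj₂ refl) (inj₁ refl))
            (fans-separated cut-b cut-c Fb Fc b≢c (inj₂ refl) (inj₂ refl))))
        card
      where
      Fa : Fan a b c (da ∸ 1)
      Fa = fan-avoiding-one Da (≢-sym a≢b) b⇝c
      Fb : Fan b a c (db ∸ 1)
      Fb = fan-avoiding-one Db a≢b a⇝c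
      Fc : Fan c a b (dc ∸ 1 ∸ 1)
      Fc = fan-avoiding-two Dc a≢c b≢c
      Ba : Fin (da ∸ 1) → Branch
      Ba = fan-branches cut-a Fa
      Bb : Fin (db ∸ 1) → Branch
      Bb = fan-branches cut-b Fb
      Bc : Fin (dc ∸ 1 ∸ 1) → Branch
      Bc = fan-branches cut-c Fc

    separator-unique : ∀ {x y z} → x ≢ z → y ≢ x → y ≢ z → ¬ (y ⇝ z ∖ x) → y ⇝ x ∖ z
    separator-unique {x} {y} x≢z y≢x y≢z ¬y⇝z with reach-one-avoiding-other x≢z (conn y x) y≢x y≢z
    ... | inj₁ y⇝x = y⇝x
    ... | inj₂ y⇝z = ⊥-elim (¬y⇝z y⇝z)

    triple-bound-unordered :
      ∀ {u v w du dv dw k} → u ≢ v → u ≢ w → v ≢ w → Cut G u → Cut G v → Cut G w →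
      D G u du → D G v dv → D G w dw → Card (Pendant G) k →
      (du ∸ 1) + (dv ∸ 1) + (dw ∸ 1 ∸ 1) ≤ k ⊎ (du ∸ 1) + (dw ∸ 1) + (dv ∸ 1 ∸ 1) ≤ k
                                         ⊎ (dv ∸ 1) + (dw ∸ 1) + (du ∸ 1 ∸ 1) ≤ k
    triple-bound-unordered {u} {v} {w} u≢v u≢w v≢w cut-u cut-v cut-w Du Dv Dw card
      with reachWithout? u v w | reachWithout? v u w
    ... | yes v⇝w∖u | yes u⇝w∖v =
      inj₁ (triple-bound u≢v u≢w v≢w cut-u cut-v cut-w Du Dv Dw v⇝w∖u u⇝w∖v card)
    ... | yes v⇝w∖u | no ¬u⇝w∖v =
      inj₂ (inj₁ (triple-bound u≢w u≢v (≢-sym v≢w) cut-u cut-w cut-v Du Dw Dv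
        (reach-sym Adj-sym v⇝w∖u) (separator-unique v≢w u≢v u≢w ¬u⇝w∖v) card))
    ... | no ¬v⇝w∖u | _ =
      inj₂ (inj₂ (triple-bound v≢w (≢-sym u≢v) (≢-sym u≢w) cut-v cut-w cut-u Dv Dw Du
        (separator-unique u≢v (≢-sym u≢w) (≢-sym v≢w) (¬v⇝w∖u ∘ reach-sym Adj-sym))
        (separator-unique u≢w (≢-sym u≢v) v≢w ¬v⇝w∖u) card))

-- Matchings and the threshold ℳ + ℛ

module _ {n : ℕ} (G : BipGraph n) {L : Subset n → Set} where

  maxMatch-unique : ∀ {m m′} → MaxMatch G L m → MaxMatch G L m′ → m ≡ m′
  maxMatch-unique ((ps , legal , refl) , maximal) ((ps′ , legal′ , refl) , maximal′) =
    ℕₚ.≤-antisym (maximal′ ps legal) (maximal ps′ legal′)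

  length-pairElems : ∀ ps → length (pairElems G ps) ≡ 2 * length ps
  length-pairElems []      = refl
  length-pairElems (_ ∷ ps) =
    trans (cong (λ l → suc (suc l)) (length-pairElems ps)) (sym (ℕₚ.*-suc 2 (length ps)))

  all-pairElems : ∀ {ps} → All.All (λ { (S , T) → L S × L T × LegalPair G S T }) ps →
                  All.All L (pairElems G ps)
  all-pairElems []                    = []
  all-pairElems ((LS , LT , _) ∷ LSTs) = LS ∷ LT ∷ all-pairElems LSTs

  legalMatching-≤ : ∀ {k ps} → Card L k → LegalMatching G L ps → 2 * length ps ≤ k
  legalMatching-≤ {ps = ps} card (legal , unique) =
    subst (_≤ _) (length-pairElems ps)
      (injection⇒≤-card card (List.lookup (pairElems G ps)) (lookup-injective unique)
                        (All.lookup (all-pairElems legal) ∘ ∈-lookup))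

  maxMatch-≤ : ∀ {k m} → Card L k → MaxMatch G L m → 2 * m ≤ k
  maxMatch-≤ card ((ps , legal , refl) , _) = legalMatching-≤ card legal

  M+R≡threshold : ∀ {k m m′ r} → Card L k → MaxMatch G L m → MaxMatch G L m′ → RVal G L r →
                  m′ + r ≡ k ∸ m
  M+R≡threshold {k} {m} card mm mm′ (l , m″ , card′ , mm″ , refl)
    rewrite card-unique card′ card | maxMatch-unique mm″ mm | maxMatch-unique mm′ mm = begin
      m + (k ∸ 2 * m)   ≡⟨ ℕₚ.+-∸-assoc m (maxMatch-≤ card mm) ⟨
      (m + k) ∸ 2 * m   ≡⟨ cong ((m + k) ∸_) (cong (m +_) (ℕₚ.+-identityʳ m)) ⟩
      (m + k) ∸ (m + m) ≡⟨ ℕₚ.[m+n]∸[m+o]≡n∸o m k m ⟩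
      k ∸ m             ∎
    where open ≡-Reasoning

module _ {x m : ℕ} (m≤x : m ≤ x) where
  open ℕₚ.≤-Reasoning

  pair-above-threshold : ∀ {a b} → x < a → x ≤ b → a + b ≤ x + m → ⊥
  pair-above-threshold {a} {b} x<a x≤b a+b≤x+m = ℕₚ.<-irrefl refl (begin-strict
    x + m ≤⟨ ℕₚ.+-monoʳ-≤ x m≤x ⟩
    x + x <⟨ ℕₚ.+-mono-<-≤ x<a x≤b ⟩
    a + b ≤⟨ a+b≤x+m ⟩
    x + m ∎)

  triple-at-threshold : x + x + (x ∸ 1) ≤ x + m → x + m ≤ 2
  triple-at-threshold bound = begin
    x + m ≤⟨ ℕₚ.+-monoʳ-≤ x m≤x ⟩
    x + x ≤⟨ ℕₚ.+-mono-≤ x≤1 x≤1 ⟩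
    2     ∎
    where
    x∸1≤0 : x ∸ 1 ≤ 0
    x∸1≤0 = ℕₚ.+-cancelˡ-≤ (x + x) (x ∸ 1) 0 (begin
      x + x + (x ∸ 1) ≤⟨ bound ⟩
      x + m           ≤⟨ ℕₚ.+-monoʳ-≤ x m≤x ⟩
      x + x           ≡⟨ ℕₚ.+-identityʳ (x + x) ⟨
      x + x + 0       ∎)
    x≤1 : x ≤ 1
    x≤1 = ℕₚ.m∸n≡0⇒m≤n (ℕₚ.n≤0⇒n≡0 x∸1≤0)

pair-at-threshold : ∀ {x m r} → m + r ≡ x → x + x ≤ x + m → r ≡ 0
pair-at-threshold {x} {m} {r} refl bound = ℕₚ.n≤0⇒n≡0 (ℕₚ.+-cancelˡ-≤ m r 0 (begin
  m + r ≤⟨ ℕₚ.+-cancelˡ-≤ x (m + r) m bound ⟩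
  m     ≡⟨ ℕₚ.+-identityʳ m ⟨
  m + 0 ∎))
  where open ℕₚ.≤-Reasoning

module _ {n : ℕ} (G : BipGraph n) (conn : Connected G) {k m : ℕ} (card : Card (Pendant G) k)
         (mm : MaxMatch G (Pendant G) m) where

  matching≤threshold : m ≤ k ∸ m
  matching≤threshold =
    ℕₚ.m+n≤o⇒m≤o∸n m (subst (_≤ k) (cong (m +_) (ℕₚ.+-identityʳ m)) (maxMatch-≤ G card mm))

  card≡threshold+matching : k ≡ (k ∸ m) + m
  card≡threshold+matching = sym (ℕₚ.m∸n+n≡m (ℕₚ.m+n≤o⇒m≤o m (maxMatch-≤ G card mm)))

  critical⇒at-threshold : ∀ {u} → Critical G u → ∃ λ d → D G u d × d ∸ 1 ≡ k ∸ m
  critical⇒at-threshold (_ , d , _ , _ , Du , mm′ , rv , d∸1≡) =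
    d , Du , trans d∸1≡ (M+R≡threshold G card mm mm′ rv)

  massive⇒above-threshold : ∀ {u} → Massive G u → ∃ λ d → D G u d × k ∸ m < d ∸ 1
  massive⇒above-threshold (_ , d , _ , _ , Du , mm′ , rv , <d∸1) =
    d , Du , subst (_< d ∸ 1) (M+R≡threshold G card mm mm′ rv) <d∸1

  critical-pair⇒R≡0 : ∀ {u v r} → Critical G u → Critical G v → u ≢ v → RVal G (Pendant G) r → r ≡ 0
  critical-pair⇒R≡0 cu@(cut-u , _) cv@(cut-v , _) u≢v rv =
    let du , Du , du≡ = critical⇒at-threshold cu
        dv , Dv , dv≡ = critical⇒at-threshold cv
    in pair-at-threshold (M+R≡threshold G card mm mm rv)
         (subst₂ _≤_ (cong₂ _+_ du≡ dv≡) card≡threshold+matching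
                 (pair-bound G conn u≢v cut-u cut-v Du Dv card))

  no-critical-triple : ∀ {u v w} → 3 < k → Critical G u → Critical G v → Critical G w →
                       u ≢ v → u ≢ w → v ≢ w → ⊥
  no-critical-triple 3<k cu cv cw u≢v u≢w v≢w
    with critical⇒at-threshold cu | critical⇒at-threshold cv | critical⇒at-threshold cw
  ... | du , Du , du≡ | dv , Dv , dv≡ | dw , Dw , dw≡ =
    [ too-many du≡ dv≡ dw≡ , [ too-many du≡ dw≡ dv≡ , too-many dv≡ dw≡ du≡ ]′ ]′
      (triple-bound-unordered G conn u≢v u≢w v≢w (proj₁ cu) (proj₁ cv) (proj₁ cw) Du Dv Dw card)
    where
    too-many : ∀ {a b c} → a ≡ k ∸ m → b ≡ k ∸ m → c ≡ k ∸ m → a + b + (c ∸ 1) ≤ k → ⊥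
    too-many a≡ b≡ c≡ bound = ℕₚ.<⇒≱ 3<k (ℕₚ.m≤n⇒m≤1+n (subst (_≤ 2) (sym card≡threshold+matching)
      (triple-at-threshold matching≤threshold
        (subst₂ _≤_ (cong₂ _+_ (cong₂ _+_ a≡ b≡) (cong (_∸ 1) c≡)) card≡threshold+matching
                bound))))

  massive-unique : ∀ {u v} → Massive G u → Massive G v → u ≡ v
  massive-unique {u} {v} mu mv with massive⇒above-threshold mu | massive⇒above-threshold mv | u ≟ v
  ... | _ | _ | yes u≡v = u≡v
  ... | du , Du , <du∸1 | dv , Dv , <dv∸1 | no u≢v = ⊥-elim
    (pair-above-threshold matching≤threshold <du∸1 (ℕₚ.<⇒≤ <dv∸1)
      (subst (_ ≤_) card≡threshold+matching (pair-bound G conn u≢v (proj₁ mu) (proj₁ mv) Du Dv card)))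

  massive⇒¬critical : ∀ {u v} → Massive G u → Critical G v → ⊥
  massive⇒¬critical {u} {v} mu cv with massive⇒above-threshold mu | critical⇒at-threshold cv | u ≟ v
  ... | du , Du , <du∸1 | dv , Dv , dv≡ | yes refl =
    ℕₚ.<-irrefl (sym dv≡) (subst (λ d → _ < d ∸ 1) (card-unique Du Dv) <du∸1)
  ... | du , Du , <du∸1 | dv , Dv , dv≡ | no u≢v =
    pair-above-threshold matching≤threshold <du∸1 (ℕₚ.≤-reflexive (sym dv≡))
      (subst (_ ≤_) card≡threshold+matching (pair-bound G conn u≢v (proj₁ mu) (proj₁ cv) Du Dv card))

lemma6 : ∀ {n} (G : BipGraph n) → Connected G → AtLeastTwoInA G → AtLeastTwoInB G
         → (∃ λ k → Card (Pendant G) k × 3 < k)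
         → ((∀ u v w → Critical G u → Critical G v → Critical G w
              → u ≢ v → v ≢ w → u ≢ w → ⊥)
            × (∀ u v → Critical G u → Critical G v → u ≢ v
              → ∀ r → RVal G (Pendant G) r → r ≡ 0))
           × ((∀ u v → Massive G u → Massive G v → u ≡ v)
            × (∀ u v → Massive G u → Critical G v → ⊥))
lemma6 G conn _ _ (_ , card , 3<k) =
  ( (λ _ _ _ cu cv cw u≢v v≢w u≢w →
       no-critical-triple G conn card (proj₂ (critical-matching cu)) 3<k cu cv cw u≢v u≢w v≢w)
  , (λ _ _ cu cv u≢v _ → critical-pair⇒R≡0 G conn card (proj₂ (critical-matching cu)) cu cv u≢v) )
  , ( (λ _ _ mu → massive-unique G conn card (proj₂ (massive-matching mu)) mu)
    , (λ _ _ mu → massive⇒¬critical G conn card (proj₂ (massive-matching mu)) mu) )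
  where
  critical-matching : ∀ {u} → Critical G u → ∃ (MaxMatch G (Pendant G))
  critical-matching (_ , _ , m , _ , _ , mm , _) = m , mm
  massive-matching : ∀ {u} → Massive G u → ∃ (MaxMatch G (Pendant G))
  massive-matching (_ , _ , m , _ , _ , mm , _) = m , mm
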